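{- Let $t\ge 1$ and let $F$ be a bipartite graph with parts $A$ and $B$ constructed as follows. Start with a single edge (one endpoint in $A$, the other in $B$), and apply any sequence of the following operations until $|B|=t$: take any edge $ab$ created so far with $a\in A$, $b\in B$; add two new vertices $c\in A$, $d\in B$ and the edges $bc$, $cd$, $ad$; then add any number $r\ge 0$ of new vertices $f\in B$, each with the edges $af$ and $fc$. Let $G$ be a bipartite graph with parts $X$ and $Y$ having at least one edge, and assume that for every edge $xy\in E(G)$ with $x\in X$, $y\in Y$, the vertex $y$ has at least $t$ neighbours $z$ with $d(\{x,z\})\ge t$. Then $G$ contains $F$ as a subgraph.
   Context: For a set $S$ of vertices, $d(S)$ is the number of common neighbours of all vertices of $S$. -}

module Defs where

open import Data.Nat using (ℕ; zero; suc; _+_; _≤_; _<_; _≤ᵇ_)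
open import Data.Bool using (Bool; true; false; _∧_)
open import Data.Fin using (Fin; toℕ)
open import Data.List using (List; length; filterᵇ; allFin)
open import Data.Product using (Σ; _×_; _,_)
open import Data.Sum using (_⊎_; inj₁; inj₂)
open import Data.Empty using (⊥)
open import Relation.Binary.PropositionalEquality using (_≡_)
open import Function.Definitions using (Injective)

-- The graph F.
-- F has parts A = {0,…,p-1} and B = {0,…,q-1} (vertices coded by ℕ),
-- and its edge relation is  adj a b  (a ∈ A, b ∈ B).

-- One construction step applied to the edge ab (a ∈ A, b ∈ B) of a graph
-- with p A-vertices and q B-vertices: new c = p ∈ A, new d = q ∈ B,
-- and r new B-vertices f = q+1, …, q+r.
extend : (ℕ → ℕ → Set) → (p q a b r : ℕ) → ℕ → ℕ → Set
extend adj p q a b r i j =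
  adj i j
  ⊎ (i ≡ p × j ≡ b)
  ⊎ (i ≡ p × j ≡ q)
  ⊎ (i ≡ a × j ≡ q)
  ⊎ (i ≡ a × q < j × j ≤ q + r)
  ⊎ (i ≡ p × q < j × j ≤ q + r)

data Built : (p q : ℕ) → (ℕ → ℕ → Set) → Set₁ where
  base : Built 1 1 (λ i j → i ≡ 0 × j ≡ 0)
  step : ∀ {p q adj} → Built p q adj →
         (a b : ℕ) → a < p → b < q → adj a b → (r : ℕ) →
         Built (suc p) (suc q + r) (extend adj p q a b r)

countFin : (n : ℕ) → (Fin n → Bool) → ℕ
countFin n P = length (filterᵇ P (allFin n))

codeg : {m n : ℕ} → (Fin m → Fin n → Bool) → Fin m → Fin m → ℕ
codeg {n = n} E x z = countFin n (λ y → E x y ∧ E z y)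

BipEdge : {P Q : Set} → (P → Q → Set) → P ⊎ Q → P ⊎ Q → Set
BipEdge E (inj₁ x) (inj₂ y) = E x y
BipEdge E (inj₂ y) (inj₁ x) = E x y
BipEdge E (inj₁ _) (inj₁ _) = ⊥
BipEdge E (inj₂ _) (inj₂ _) = ⊥

Contains : {m n : ℕ} → (Fin m → Fin n → Bool) →
           (p q : ℕ) → (ℕ → ℕ → Set) → Set
Contains {m} {n} E p q adj =
  Σ (Fin p ⊎ Fin q → Fin m ⊎ Fin n) λ φ →
    Injective _≡_ _≡_ φ ×
    (∀ u v → BipEdge (λ (a : Fin p) (b : Fin q) → adj (toℕ a) (toℕ b)) u v →
             BipEdge (λ x y → E x y ≡ true) (φ u) (φ v))

-- Embed F greedily, following its construction, while keeping the images of
-- the p A-vertices and q B-vertices built so far distinct (p ≤ q ≤ t throughout).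
-- At a step on an edge ab mapped to xy, the hypothesis offers at least t
-- neighbours z of y with d({x,z}) ≥ t; fewer than t of them are already used
-- (p ≤ q < t), so a fresh one can serve as c.  Then x and c have at least t
-- common neighbours, at most q of which are used, leaving 1 + r ≤ t − q fresh
-- ones for d and the vertices f.
module Submission where

open import Defs
open import Data.Nat using (ℕ; zero; suc; _+_; _≤_; _<_; _≤ᵇ_; s≤s; z≤n; _≟_)
open import Data.Nat.Properties
  using ( ≤-refl; ≤-reflexive; ≤-trans; ≤-<-trans; ≤-pred; <⇒≤; <⇒≢; ≤⇒≯; ≤ᵇ⇒≤
        ; n≤1+n; n<1+n; n<1⇒n≡0; m≤n⇒m≤1+n; m≤m+n; m<m+n; m<1+n⇒m<n∨m≡n; m≤n⇒m<n∨m≡n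
        ; +-comm; +-suc; +-identityʳ )
open import Data.Bool using (Bool; true; false; _∧_; not; if_then_else_)
open import Data.Bool.Properties using (∧-conicalˡ; ∧-conicalʳ; T-≡)
open import Data.Fin using (Fin; toℕ) renaming (zero to fzero; suc to fsuc)
open import Data.Fin.Properties using (toℕ-injective; toℕ<n) renaming (_≟_ to _≟ᶠ_)
open import Data.List using (_∷_; length; filterᵇ; allFin; tabulate)
open import Data.List.Membership.Propositional using (_∈_)
open import Data.List.Membership.Propositional.Properties using (∈-filter⁻)
open import Data.List.Relation.Unary.Any using (here)
open import Data.Product using (Σ; ∃; _×_; _,_; proj₁; proj₂)
open import Data.Sum using (_⊎_; inj₁; inj₂)
open import Data.Sum.Properties using (inj₁-injective; inj₂-injective)
open import Function using (_∘_; id; Equivalence)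
open import Relation.Nullary using (does; yes; no; T?; contradiction)
open import Relation.Binary.PropositionalEquality

-- The conjuncts are ordered so that (P ∖ v) reduces on constructors of Fin,
-- e.g. (P ∖ fsuc v) ∘ fsuc is definitionally (P ∘ fsuc) ∖ v.
_∖_ : ∀ {n} → (Fin n → Bool) → Fin n → Fin n → Bool
(P ∖ v) y = not (does (y ≟ᶠ v)) ∧ P y

∖-≢ : ∀ {n} (P : Fin n → Bool) v y → (P ∖ v) y ≡ true → y ≢ v
∖-≢ P v y h with y ≟ᶠ v
∖-≢ P v y () | yes _
∖-≢ P v y h  | no y≢v = y≢v

countFin-tabulate : ∀ {A : Set} {n} (f : Fin n → A) (P : A → Bool) →
                    length (filterᵇ P (tabulate f)) ≡ countFin n (P ∘ f)
countFin-tabulate {n = zero}  f P = refl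
countFin-tabulate {n = suc n} f P with P (f fzero)
... | true  = cong suc (trans (countFin-tabulate (f ∘ fsuc) P) (sym (countFin-tabulate fsuc (P ∘ f))))
... | false = trans (countFin-tabulate (f ∘ fsuc) P) (sym (countFin-tabulate fsuc (P ∘ f)))

countFin-suc : ∀ {n} (P : Fin (suc n) → Bool) →
               countFin (suc n) P ≡ (if P fzero then suc else id) (countFin n (P ∘ fsuc))
countFin-suc P with P fzero
... | true  = cong suc (countFin-tabulate fsuc P)
... | false = countFin-tabulate fsuc P

countFin-∖ : ∀ {n} (P : Fin n → Bool) v → countFin n P ≤ suc (countFin n (P ∖ v))
countFin-∖ {suc _} P v rewrite countFin-suc P | countFin-suc (P ∖ v) with v | P fzero
... | fzero  | true  = ≤-refl
... | fzero  | false = n≤1+n _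
... | fsuc v | true  = s≤s (countFin-∖ (P ∘ fsuc) v)
... | fsuc v | false = countFin-∖ (P ∘ fsuc) v

countFin-witness : ∀ {n} (P : Fin n → Bool) → 0 < countFin n P → ∃ λ y → P y ≡ true
countFin-witness {n} P pos with filterᵇ P (allFin n) in eq
... | y ∷ _ = y , Equivalence.to T-≡ (proj₂ (∈-filter⁻ (T? ∘ P) {xs = allFin n} (subst (y ∈_) (sym eq) (here refl))))

countFin-fresh : ∀ {n} (P : Fin n → Bool) (f : ℕ → Fin n) q → q < countFin n P →
                 ∃ λ y → P y ≡ true × (∀ j → j < q → f j ≢ y)
countFin-fresh P f zero pos with y , Py ← countFin-witness P pos = y , Py , λ _ ()
countFin-fresh P f (suc q) bound
  with y , Py , fresh ← countFin-fresh (P ∖ f q) f q (≤-pred (≤-trans bound (countFin-∖ P (f q))))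
  = y , ∧-conicalʳ _ _ Py , fresh′
  where
  fresh′ : ∀ j → j < suc q → f j ≢ y
  fresh′ j j<1+q with m<1+n⇒m<n∨m≡n j<1+q
  ... | inj₁ j<q  = fresh j j<q
  ... | inj₂ refl = ∖-≢ P (f q) y Py ∘ sym

InjectiveBelow : ∀ {A : Set} → (ℕ → A) → ℕ → Set
InjectiveBelow f q = ∀ i j → i < q → j < q → f i ≡ f j → i ≡ j

injectiveBelow-1 : ∀ {A : Set} (f : ℕ → A) → InjectiveBelow f 1
injectiveBelow-1 f i j i<1 j<1 _ = trans (n<1⇒n≡0 i<1) (sym (n<1⇒n≡0 j<1))

_[_≔_] : ∀ {A : Set} → (ℕ → A) → ℕ → A → ℕ → A
(f [ q ≔ y ]) j with j ≟ q
... | yes _ = y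
... | no  _ = f j

≔-at : ∀ {A : Set} (f : ℕ → A) q y → (f [ q ≔ y ]) q ≡ y
≔-at f q y with q ≟ q
... | yes _   = refl
... | no q≢q = contradiction refl q≢q

≔-other : ∀ {A : Set} (f : ℕ → A) {q} y {j} → j ≢ q → (f [ q ≔ y ]) j ≡ f j
≔-other f {q} y {j} j≢q with j ≟ q
... | yes j≡q = contradiction j≡q j≢q
... | no  _   = refl

≔-injectiveBelow : ∀ {A : Set} {f : ℕ → A} {q y} → InjectiveBelow f q →
                   (∀ j → j < q → f j ≢ y) → InjectiveBelow (f [ q ≔ y ]) (suc q)
≔-injectiveBelow {f = f} {q} {y} inj fresh i j i<1+q j<1+q eq
  with m<1+n⇒m<n∨m≡n i<1+q | m<1+n⇒m<n∨m≡n j<1+q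
... | inj₁ i<q  | inj₁ j<q  =
  inj i j i<q j<q (trans (sym (≔-other f y (<⇒≢ i<q))) (trans eq (≔-other f y (<⇒≢ j<q))))
... | inj₁ i<q  | inj₂ refl = contradiction (trans (sym (≔-other f y (<⇒≢ i<q))) (trans eq (≔-at f q y))) (fresh i i<q)
... | inj₂ refl | inj₁ j<q  = contradiction (trans (sym (≔-other f y (<⇒≢ j<q))) (trans (sym eq) (≔-at f q y))) (fresh j j<q)
... | inj₂ refl | inj₂ refl = refl

record FreshExtension {n} (f : ℕ → Fin n) (q k : ℕ) (P : Fin n → Bool) : Set where
  field
    g         : ℕ → Fin n
    agrees    : ∀ j → j < q → g j ≡ f j
    injective : InjectiveBelow g (q + k)
    satisfies : ∀ j → q ≤ j → j < q + k → P (g j) ≡ true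

freshExtension : ∀ {n} (f : ℕ → Fin n) q k (P : Fin n → Bool) →
                 InjectiveBelow f q → q + k ≤ countFin n P → FreshExtension f q k P
freshExtension f q zero P inj _ = record
  { g         = f
  ; agrees    = λ _ _ → refl
  ; injective = subst (InjectiveBelow f) (sym (+-identityʳ q)) inj
  ; satisfies = λ j q≤j j<q+0 → contradiction (subst (j <_) (+-identityʳ q) j<q+0) (≤⇒≯ q≤j)
  }
freshExtension f q (suc k) P inj bound = record
  { g         = G.g
  ; agrees    = λ j j<q → trans (G.agrees j (m≤n⇒m≤1+n j<q)) (≔-other f y (<⇒≢ j<q))
  ; injective = subst (InjectiveBelow G.g) (sym (+-suc q k)) G.injective
  ; satisfies = satisfies
  }
  where
  bound′ : suc q + k ≤ countFin _ P
  bound′ = subst (_≤ countFin _ P) (+-suc q k) bound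
  picked : ∃ λ y → P y ≡ true × (∀ j → j < q → f j ≢ y)
  picked = countFin-fresh P f q (≤-trans (s≤s (m≤m+n q k)) bound′)
  y : Fin _
  y = proj₁ picked
  module G = FreshExtension
    (freshExtension (f [ q ≔ y ]) (suc q) k P (≔-injectiveBelow inj (proj₂ (proj₂ picked))) bound′)
  satisfies : ∀ j → q ≤ j → j < q + suc k → P (G.g j) ≡ true
  satisfies j q≤j j<q+1+k with m≤n⇒m<n∨m≡n q≤j
  ... | inj₁ q<j  = G.satisfies j q<j (subst (j <_) (+-suc q k) j<q+1+k)
  ... | inj₂ refl = trans (cong P (trans (G.agrees q (n<1+n q)) (≔-at f q y))) (proj₁ (proj₂ picked))

Built⇒bounded : ∀ {p q adj} → Built p q adj → ∀ i j → adj i j → i < p × j < q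
Built⇒bounded base _ _ (refl , refl) = s≤s z≤n , s≤s z≤n
Built⇒bounded (step {p} {q} bld a b a<p b<q _ r) i j ij with ij
... | inj₁ old with i<p , j<q ← Built⇒bounded bld i j old = m≤n⇒m≤1+n i<p , m≤n⇒m≤1+n (≤-trans j<q (m≤m+n q r))
... | inj₂ (inj₁ (refl , refl))                              = n<1+n p , m≤n⇒m≤1+n (≤-trans b<q (m≤m+n q r))
... | inj₂ (inj₂ (inj₁ (refl , refl)))                       = n<1+n p , s≤s (m≤m+n q r)
... | inj₂ (inj₂ (inj₂ (inj₁ (refl , refl))))                = m≤n⇒m≤1+n a<p , s≤s (m≤m+n q r)
... | inj₂ (inj₂ (inj₂ (inj₂ (inj₁ (refl , _ , j≤q+r)))))   = m≤n⇒m≤1+n a<p , s≤s j≤q+r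
... | inj₂ (inj₂ (inj₂ (inj₂ (inj₂ (refl , _ , j≤q+r)))))   = n<1+n p , s≤s j≤q+r

Built⇒p≤q : ∀ {p q adj} → Built p q adj → p ≤ q
Built⇒p≤q base                           = ≤-refl
Built⇒p≤q (step {q = q} bld _ _ _ _ _ r) = s≤s (≤-trans (Built⇒p≤q bld) (m≤m+n q r))

module _ {m n} (E : Fin m → Fin n → Bool) where

  record Embedding (p q : ℕ) (adj : ℕ → ℕ → Set) : Set where
    field
      fA    : ℕ → Fin m
      fB    : ℕ → Fin n
      injA  : InjectiveBelow fA p
      injB  : InjectiveBelow fB q
      edges : ∀ i j → adj i j → E (fA i) (fB j) ≡ true

  Embedding⇒Contains : ∀ {p q adj} → Embedding p q adj → Contains E p q adj
  Embedding⇒Contains {p} {q} {adj} φ = ψ , ψ-injective , ψ-edges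
    where
    open Embedding φ
    ψ : Fin p ⊎ Fin q → Fin m ⊎ Fin n
    ψ (inj₁ a) = inj₁ (fA (toℕ a))
    ψ (inj₂ b) = inj₂ (fB (toℕ b))
    ψ-injective : ∀ {u v} → ψ u ≡ ψ v → u ≡ v
    ψ-injective {inj₁ a} {inj₁ a′} eq = cong inj₁ (toℕ-injective (injA _ _ (toℕ<n a) (toℕ<n a′) (inj₁-injective eq)))
    ψ-injective {inj₂ b} {inj₂ b′} eq = cong inj₂ (toℕ-injective (injB _ _ (toℕ<n b) (toℕ<n b′) (inj₂-injective eq)))
    ψ-edges : ∀ u v → BipEdge (λ (a : Fin p) (b : Fin q) → adj (toℕ a) (toℕ b)) u v →
              BipEdge (λ x y → E x y ≡ true) (ψ u) (ψ v)
    ψ-edges (inj₁ a) (inj₂ b) ab = edges _ _ ab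
    ψ-edges (inj₂ b) (inj₁ a) ab = edges _ _ ab

  module _ (t : ℕ)
    (rich : ∀ x y → E x y ≡ true → t ≤ countFin m (λ z → E z y ∧ (t ≤ᵇ codeg E x z))) where

    embed-step : ∀ {p q adj a b r} → Embedding p q adj → (∀ i j → adj i j → i < p × j < q) →
                 a < p → b < q → adj a b → p < t → suc q + r ≤ t →
                 Embedding (suc p) (suc q + r) (extend adj p q a b r)
    embed-step {p} {q} {adj} {a} {b} {r} φ bounded a<p b<q ab p<t 1+q+r≤t = record
      { fA    = A.g
      ; fB    = B.g
      ; injA  = subst (InjectiveBelow A.g) (+-comm p 1) A.injective
      ; injB  = subst (InjectiveBelow B.g) (+-suc q r) B.injective
      ; edges = edges′
      }
      where
      open Embedding φ
      x : Fin m
      x = fA a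
      y : Fin n
      y = fB b
      module A = FreshExtension (freshExtension fA p 1 (λ z → E z y ∧ (t ≤ᵇ codeg E x z)) injA
                                  (≤-trans (≤-reflexive (+-comm p 1)) (≤-trans p<t (rich x y (edges a b ab)))))
      c : Fin m
      c = A.g p
      c-good : E c y ∧ (t ≤ᵇ codeg E x c) ≡ true
      c-good = A.satisfies p ≤-refl (m<m+n p (s≤s z≤n))
      t≤codeg : t ≤ codeg E x c
      t≤codeg = ≤ᵇ⇒≤ t _ (Equivalence.from T-≡ (∧-conicalʳ _ _ c-good))
      module B = FreshExtension (freshExtension fB q (suc r) (λ w → E x w ∧ E c w) injB
                                  (≤-trans (≤-reflexive (+-suc q r)) (≤-trans 1+q+r≤t t≤codeg)))
      common : ∀ j → q ≤ j → j ≤ q + r → E x (B.g j) ≡ true × E c (B.g j) ≡ true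
      common j q≤j j≤q+r = ∧-conicalˡ _ _ xc , ∧-conicalʳ _ _ xc
        where
        xc : E x (B.g j) ∧ E c (B.g j) ≡ true
        xc = B.satisfies j q≤j (≤-trans (s≤s j≤q+r) (≤-reflexive (sym (+-suc q r))))
      a-common : ∀ j → q ≤ j → j ≤ q + r → E (A.g a) (B.g j) ≡ true
      a-common j q≤j j≤q+r = trans (cong (λ u → E u (B.g j)) (A.agrees a a<p)) (proj₁ (common j q≤j j≤q+r))
      edges′ : ∀ i j → extend adj p q a b r i j → E (A.g i) (B.g j) ≡ true
      edges′ i j (inj₁ ij) with i<p , j<q ← bounded i j ij =
        trans (cong₂ E (A.agrees i i<p) (B.agrees j j<q)) (edges i j ij)
      edges′ _ _ (inj₂ (inj₁ (refl , refl))) = trans (cong (E c) (B.agrees b b<q)) (∧-conicalˡ _ _ c-good)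
      edges′ _ _ (inj₂ (inj₂ (inj₁ (refl , refl)))) = proj₂ (common q ≤-refl (m≤m+n q r))
      edges′ _ _ (inj₂ (inj₂ (inj₂ (inj₁ (refl , refl))))) = a-common q ≤-refl (m≤m+n q r)
      edges′ _ j (inj₂ (inj₂ (inj₂ (inj₂ (inj₁ (refl , q<j , j≤q+r)))))) = a-common j (<⇒≤ q<j) j≤q+r
      edges′ _ j (inj₂ (inj₂ (inj₂ (inj₂ (inj₂ (refl , q<j , j≤q+r)))))) = proj₂ (common j (<⇒≤ q<j) j≤q+r)

    embed : ∀ {x₀ y₀} → E x₀ y₀ ≡ true → ∀ {p q adj} → Built p q adj → q ≤ t → Embedding p q adj
    embed {x₀} {y₀} e₀ base _ = record
      { fA = λ _ → x₀ ; fB = λ _ → y₀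
      ; injA = injectiveBelow-1 _ ; injB = injectiveBelow-1 _
      ; edges = λ _ _ _ → e₀ }
    embed e₀ (step {q = q} bld a b a<p b<q ab r) 1+q+r≤t =
      embed-step (embed e₀ bld (<⇒≤ q<t)) (Built⇒bounded bld) a<p b<q ab
                 (≤-<-trans (Built⇒p≤q bld) q<t) 1+q+r≤t
      where
      q<t : q < t
      q<t = ≤-trans (m≤m+n (suc q) r) 1+q+r≤t

lemma4p3 : (t : ℕ) → 1 ≤ t →
    (p : ℕ) (adj : ℕ → ℕ → Set) → Built p t adj →
    (m n : ℕ) (E : Fin m → Fin n → Bool) →
    Σ (Fin m) (λ x → Σ (Fin n) (λ y → E x y ≡ true)) →
    (∀ x y → E x y ≡ true →
      t ≤ countFin m (λ z → E z y ∧ (t ≤ᵇ codeg E x z))) →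
    Contains E p t adj
lemma4p3 t _ p adj bld m n E (_ , _ , e₀) rich =
  Embedding⇒Contains E (embed E t rich e₀ bld ≤-refl)
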